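{- Let $f(u,v)=au^2+buv+cv^2$ be a reduced positive definite binary quadratic form of discriminant $-D$. Let $\ell,r,s$ be integers with $\ell\geq1$ and $0\leq r,s<\ell$. Then $$\#\left\{(u,v)\in\mathbb{Z}^2:\ f\left(u-\frac{r}{\ell},\,v-\frac{s}{\ell}\right)<\frac{f(u,v)}{2}\right\}\ll\frac{\sqrt{D}}{a},$$ with an absolute implied constant.
   Context: The discriminant of $f(u,v)=au^2+buv+cv^2$ ($a,b,c\in\mathbb{Z}$) is $-D=b^2-4ac$; positive definite means $D>0$ and $a>0$; primitive means $\gcd(a,b,c)=1$. A primitive positive definite form is reduced if $|b|\leq a\leq c$ and, whenever $|b|=a$ or $a=c$, also $b\geq0$. Here $f$ is evaluated at real arguments by the same polynomial formula. -}

module Defs where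

open import Data.Integer using (ℤ; +_; _+_; _-_; _*_; _≤_; _<_; ∣_∣; 0ℤ; 1ℤ)
open import Data.Integer.GCD using (gcd)
open import Data.Product using (_×_; _,_)
open import Data.Sum using (_⊎_)
open import Relation.Binary.PropositionalEquality using (_≡_)

form : ℤ → ℤ → ℤ → ℤ → ℤ → ℤ
form a b c u v = a * u * u + b * u * v + c * v * v

negDisc : ℤ → ℤ → ℤ → ℤ
negDisc a b c = + 4 * a * c - b * b

Primitive : ℤ → ℤ → ℤ → Set
Primitive a b c = gcd (gcd a b) c ≡ 1ℤ

PositiveDefinite : ℤ → ℤ → ℤ → Set
PositiveDefinite a b c = (0ℤ < negDisc a b c) × (0ℤ < a)

Reduced : ℤ → ℤ → ℤ → Set
Reduced a b c =
  Primitive a b c × PositiveDefinite a b c ×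
  (+ ∣ b ∣ ≤ a) × (a ≤ c) ×
  (((+ ∣ b ∣ ≡ a) ⊎ (a ≡ c)) → 0ℤ ≤ b)

-- f(u - r/ℓ, v - s/ℓ) < f(u,v)/2, cleared of denominators by multiplying by 2ℓ² > 0:
-- 2 f(ℓu - r, ℓv - s) < ℓ² f(u,v).
InRegion : ℤ → ℤ → ℤ → ℤ → ℤ → ℤ → ℤ × ℤ → Set
InRegion a b c ℓ r s (u , v) =
  + 2 * form a b c (ℓ * u - r) (ℓ * v - s) < ℓ * ℓ * form a b c u v

-- Write f for the form, X = (ℓu, ℓv) and R = (r, s), so that the region is 2 f(X − R) < f(X).
-- The identity 12 f(R) − f(X) = 2 f(X − 3R) + 3 (f(X) − 2 f(X − R)) and f ≥ 0 give
-- f(X) < 12 f(R), and |b| ≤ a ≤ c with 0 ≤ r, s < ℓ give f(R) ≤ 3cℓ², so f(u, v) < 36c.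
-- Completing the square, 4a f = (2au + bv)² + D v² and 4c f = (2cv + bu)² + D u², while
-- D ≥ 3ac; hence 4f ≥ 3c v² and 4f ≥ 3a u², so |v| ≤ 6 and a u² < 48c.  With U the largest
-- |u|, the points thus lie in a box of 13 (2U + 1) lattice points, a U² ≤ 48c, and
-- (13 (2U + 1))² a² ≪ ac ≤ D.

module Submission where

open import Defs
open import Data.Nat using (ℕ)
open import Data.Integer using (ℤ; +_; _*_; _≤_; _<_; 0ℤ; 1ℤ)
open import Data.Product using (_×_; ∃; _,_; proj₁; proj₂)
open import Data.List using (List; []; _∷_; _++_; length; map; cartesianProduct)
open import Data.List.Relation.Unary.All using (All)
open import Data.List.Relation.Unary.Unique.Propositional using (Unique)

import Data.Nat as ℕ
import Data.Nat.Properties as ℕ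
open import Data.Integer using (-[1+_]; _+_; _-_; -_; ∣_∣; +≤+; -≤+; NonNegative; nonNegative; positive)
open import Data.Integer.Properties
  using ( ≤-refl; ≤-trans; <⇒≤; <-≤-trans; i≤i+j; i≤j⇒0≤j-i; suc[i]≤j⇒i<j; i<j⇒suc[i]≤j
        ; ∣-i∣≡∣i∣; neg-involutive; *-zeroʳ; *-assoc; pos-*; pos-+; drop‿+<+
        ; +-mono-≤; *-monoˡ-≤-nonNeg; *-monoʳ-≤-nonNeg; *-monoˡ-<-pos
        ; *-cancelˡ-≤-pos; *-cancelˡ-<-nonNeg; module ≤-Reasoning )
open import Data.Integer.Solver using (module +-*-Solver)
open +-*-Solver using (Polynomial; con; _:+_; _:-_; _:*_; _:=_; solve)
open import Data.Sum using (inj₁; inj₂)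
open import Data.List.Properties using (length-++; length-map)
open import Data.List.Extrema.Nat using (argmax; argmax-all; f[xs]≤f[argmax])
open import Data.List.Relation.Unary.AllPairs using (_∷_)
import Data.List.Relation.Unary.All as All
open import Data.List.Relation.Unary.Any using (here; there)
open import Data.List.Relation.Binary.Subset.Propositional using (_⊆_)
open import Data.List.Membership.Propositional using (_∈_)
open import Data.List.Membership.Propositional.Properties
  using (∈-∃++; ∈-++⁻; ∈-++⁺ˡ; ∈-++⁺ʳ; ∈-cartesianProduct⁺)
open import Data.Empty using (⊥-elim)
open import Function using (_∘_)
open import Relation.Binary.PropositionalEquality

Unique⇒length≤ : ∀ {A : Set} {xs ys : List A} → Unique xs → xs ⊆ ys → length xs ℕ.≤ length ys
Unique⇒length≤ {xs = []}     _              _     = ℕ.z≤n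
Unique⇒length≤ {xs = x ∷ xs} (x∉xs ∷ unique) x∷xs⊆ys with ∈-∃++ (x∷xs⊆ys (here refl))
... | ys₁ , ys₂ , refl = begin
  ℕ.suc (length xs)             ≤⟨ ℕ.s≤s (Unique⇒length≤ unique xs⊆ys₁++ys₂) ⟩
  ℕ.suc (length (ys₁ ++ ys₂))   ≡⟨ cong ℕ.suc (length-++ ys₁) ⟩
  ℕ.suc (length ys₁ ℕ.+ length ys₂) ≡⟨ ℕ.+-suc (length ys₁) (length ys₂) ⟨
  length ys₁ ℕ.+ length (x ∷ ys₂) ≡⟨ length-++ ys₁ ⟨
  length (ys₁ ++ x ∷ ys₂)       ∎
  where
  open ℕ.≤-Reasoning
  xs⊆ys₁++ys₂ : xs ⊆ ys₁ ++ ys₂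
  xs⊆ys₁++ys₂ y∈xs with ∈-++⁻ ys₁ (x∷xs⊆ys (there y∈xs))
  ... | inj₁ y∈ys₁          = ∈-++⁺ˡ y∈ys₁
  ... | inj₂ (here refl)    = ⊥-elim (All.lookup x∉xs y∈xs refl)
  ... | inj₂ (there y∈ys₂)  = ∈-++⁺ʳ ys₁ y∈ys₂

length-cartesianProduct : ∀ {A B : Set} (xs : List A) (ys : List B) →
                          length (cartesianProduct xs ys) ≡ length xs ℕ.* length ys
length-cartesianProduct []       ys = refl
length-cartesianProduct (x ∷ xs) ys = begin
  length (map (x ,_) ys ++ cartesianProduct xs ys)            ≡⟨ length-++ (map (x ,_) ys) ⟩
  length (map (x ,_) ys) ℕ.+ length (cartesianProduct xs ys)  ≡⟨ cong₂ ℕ._+_ (length-map (x ,_) ys)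
                                                                    (length-cartesianProduct xs ys) ⟩
  length ys ℕ.+ length xs ℕ.* length ys                        ∎
  where open ≡-Reasoning

symRange : ℕ → List ℤ
symRange ℕ.zero    = 0ℤ ∷ []
symRange (ℕ.suc n) = + ℕ.suc n ∷ -[1+ n ] ∷ symRange n

length-symRange : ∀ n → length (symRange n) ≡ 1 ℕ.+ 2 ℕ.* n
length-symRange ℕ.zero    = refl
length-symRange (ℕ.suc n) =
  cong (2 ℕ.+_) (trans (length-symRange n) (sym (ℕ.+-suc n (n ℕ.+ 0))))

∈-symRange : ∀ {n} i → ∣ i ∣ ℕ.≤ n → i ∈ symRange n
∈-symRange {ℕ.zero}  (+ .0) ℕ.z≤n = here refl
∈-symRange {ℕ.suc n} i ∣i∣≤1+n with ℕ.m≤n⇒m<n∨m≡n ∣i∣≤1+n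
... | inj₁ ∣i∣<1+n       = there (there (∈-symRange i (ℕ.s≤s⁻¹ ∣i∣<1+n)))
∈-symRange {ℕ.suc n} (+ _)    _ | inj₂ refl = here refl
∈-symRange {ℕ.suc n} -[1+ _ ] _ | inj₂ refl = there (here refl)

length≤box : ∀ {U V} {ps : List (ℤ × ℤ)} → Unique ps →
             All (λ p → ∣ proj₁ p ∣ ℕ.≤ U) ps → All (λ p → ∣ proj₂ p ∣ ℕ.≤ V) ps →
             length ps ℕ.≤ (1 ℕ.+ 2 ℕ.* U) ℕ.* (1 ℕ.+ 2 ℕ.* V)
length≤box {U} {V} {ps} unique us vs = begin
  length ps                                             ≤⟨ Unique⇒length≤ unique ps⊆box ⟩
  length (cartesianProduct (symRange U) (symRange V))   ≡⟨ length-cartesianProduct (symRange U) (symRange V) ⟩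
  length (symRange U) ℕ.* length (symRange V)           ≡⟨ cong₂ ℕ._*_ (length-symRange U) (length-symRange V) ⟩
  (1 ℕ.+ 2 ℕ.* U) ℕ.* (1 ℕ.+ 2 ℕ.* V)                   ∎
  where
  open ℕ.≤-Reasoning
  ps⊆box : ps ⊆ cartesianProduct (symRange U) (symRange V)
  ps⊆box p∈ps = ∈-cartesianProduct⁺ (∈-symRange _ (All.lookup us p∈ps)) (∈-symRange _ (All.lookup vs p∈ps))

m*m<n*n⇒m<n : ∀ {m n} → m ℕ.* m ℕ.< n ℕ.* n → m ℕ.< n
m*m<n*n⇒m<n {m} {n} m²<n² = ℕ.≰⇒> (λ n≤m → ℕ.<⇒≱ m²<n² (ℕ.*-mono-≤ n≤m n≤m))

0≤+ : ∀ n → 0ℤ ≤ + n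
0≤+ n = +≤+ ℕ.z≤n

0≤i*j : ∀ {i j} → 0ℤ ≤ i → 0ℤ ≤ j → 0ℤ ≤ i * j
0≤i*j {i} {j} 0≤i 0≤j = subst (_≤ i * j) (*-zeroʳ i) (*-monoˡ-≤-nonNeg i {{nonNegative 0≤i}} 0≤j)

0≤i*i : ∀ i → 0ℤ ≤ i * i
0≤i*i (+ n)    = 0≤i*j (0≤+ n) (0≤+ n)
0≤i*i -[1+ n ] = +≤+ ℕ.z≤n

≤-by-gap : ∀ {i j d} → 0ℤ ≤ d → i + d ≡ j → i ≤ j
≤-by-gap {i} {d = d} 0≤d refl = i≤i+j i d {{nonNegative 0≤d}}

<-by-gap : ∀ {i j d} → 0ℤ ≤ d → (1ℤ + i) + d ≡ j → i < j
<-by-gap 0≤d eq = suc[i]≤j⇒i<j (≤-by-gap 0≤d eq)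

0≤j-[1+i] : ∀ {i j} → i < j → 0ℤ ≤ j - (1ℤ + i)
0≤j-[1+i] = i≤j⇒0≤j-i ∘ i<j⇒suc[i]≤j

i≤∣i∣ : ∀ i → i ≤ + ∣ i ∣
i≤∣i∣ (+ n)    = ≤-refl
i≤∣i∣ -[1+ n ] = -≤+

-i≤∣i∣ : ∀ i → - i ≤ + ∣ i ∣
-i≤∣i∣ i = subst (- i ≤_) (cong +_ (∣-i∣≡∣i∣ i)) (i≤∣i∣ (- i))

i*i≡∣i∣*∣i∣ : ∀ i → i * i ≡ + ∣ i ∣ * + ∣ i ∣
i*i≡∣i∣*∣i∣ (+ n)    = refl
i*i≡∣i∣*∣i∣ -[1+ n ] = refl

-- The reflection-based ring solver cannot look inside form, so identities involving it
-- are proved with the older solver; the polynomial Form evaluates definitionally to form.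
Form : ∀ {n} → (a b c x y : Polynomial n) → Polynomial n
Form a b c x y = a :* x :* x :+ b :* x :* y :+ c :* y :* y

form-scale : ∀ a b c k x y → form a b c (k * x) (k * y) ≡ k * k * form a b c x y
form-scale = solve 6 (λ a b c k x y → Form a b c (k :* x) (k :* y) := k :* k :* Form a b c x y) refl

module ReducedForm {a b c : ℤ} (0<a : 0ℤ < a) (∣b∣≤a : + ∣ b ∣ ≤ a) (a≤c : a ≤ c) where

  open ≤-Reasoning

  0≤a : 0ℤ ≤ a
  0≤a = <⇒≤ 0<a

  0≤c : 0ℤ ≤ c
  0≤c = ≤-trans 0≤a a≤c

  0≤c-a : 0ℤ ≤ c - a
  0≤c-a = i≤j⇒0≤j-i a≤c

  0≤a-b : 0ℤ ≤ a - b
  0≤a-b = i≤j⇒0≤j-i (≤-trans (i≤∣i∣ b) ∣b∣≤a)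

  0≤a+b : 0ℤ ≤ a + b
  0≤a+b = subst (λ t → 0ℤ ≤ a + t) (neg-involutive b) (i≤j⇒0≤j-i (≤-trans (-i≤∣i∣ b) ∣b∣≤a))

  0≤ac-b² : 0ℤ ≤ a * c - b * b
  0≤ac-b² = subst (0ℤ ≤_)
    (solve 3 (λ a b c → a :* (c :- a) :+ (a :- b) :* (a :+ b) := a :* c :- b :* b) refl a b c)
    (+-mono-≤ (0≤i*j 0≤a 0≤c-a) (0≤i*j 0≤a-b 0≤a+b))

  a*c≤negDisc : a * c ≤ negDisc a b c
  a*c≤negDisc = ≤-by-gap (+-mono-≤ (0≤i*j (0≤+ 2) (0≤i*j 0≤a 0≤c)) 0≤ac-b²)
    (solve 3 (λ a b c → a :* c :+ (con (+ 2) :* (a :* c) :+ (a :* c :- b :* b))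
                        := con (+ 4) :* a :* c :- b :* b) refl a b c)

  3cy²≤4form : ∀ x y → + 3 * c * (y * y) ≤ + 4 * form a b c x y
  3cy²≤4form x y = *-cancelˡ-≤-pos _ _ a {{positive 0<a}}
    (≤-by-gap (+-mono-≤ (0≤i*i (+ 2 * a * x + b * y)) (0≤i*j 0≤ac-b² (0≤i*i y)))
      (solve 5 (λ a b c x y →
         a :* (con (+ 3) :* c :* (y :* y))
           :+ ((con (+ 2) :* a :* x :+ b :* y) :* (con (+ 2) :* a :* x :+ b :* y) :+ (a :* c :- b :* b) :* (y :* y))
         := a :* (con (+ 4) :* Form a b c x y)) refl a b c x y))

  3ax²≤4form : ∀ x y → + 3 * a * (x * x) ≤ + 4 * form a b c x y
  3ax²≤4form x y = *-cancelˡ-≤-pos _ _ c {{positive (<-≤-trans 0<a a≤c)}}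
    (≤-by-gap (+-mono-≤ (0≤i*i (+ 2 * c * y + b * x)) (0≤i*j 0≤ac-b² (0≤i*i x)))
      (solve 5 (λ a b c x y →
         c :* (con (+ 3) :* a :* (x :* x))
           :+ ((con (+ 2) :* c :* y :+ b :* x) :* (con (+ 2) :* c :* y :+ b :* x) :+ (a :* c :- b :* b) :* (x :* x))
         := c :* (con (+ 4) :* Form a b c x y)) refl a b c x y))

  0≤form : ∀ x y → 0ℤ ≤ form a b c x y
  0≤form x y = *-cancelˡ-≤-pos 0ℤ (form a b c x y) (+ 4)
    (≤-trans (0≤i*j (0≤i*j (0≤+ 3) 0≤c) (0≤i*i y)) (3cy²≤4form x y))

  form<12form : ∀ {x y r s} → + 2 * form a b c (x - r) (y - s) < form a b c x y →
                form a b c x y < + 12 * form a b c r s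
  form<12form {x} {y} {r} {s} 2f[X-R]<f[X] = <-by-gap
    (+-mono-≤ (+-mono-≤ (0≤i*j (0≤+ 2) (0≤form _ _)) (0≤i*j (0≤+ 3) (0≤j-[1+i] 2f[X-R]<f[X]))) (0≤+ 2))
    (solve 7 (λ a b c x y r s →
       (con (+ 1) :+ Form a b c x y)
         :+ (con (+ 2) :* Form a b c (x :- con (+ 3) :* r) (y :- con (+ 3) :* s)
             :+ con (+ 3) :* (Form a b c x y :- (con (+ 1) :+ con (+ 2) :* Form a b c (x :- r) (y :- s)))
             :+ con (+ 2))
       := con (+ 12) :* Form a b c r s) refl a b c x y r s)

  form≤3cℓ² : ∀ {ℓ r s} → 0ℤ ≤ r → r ≤ ℓ → 0ℤ ≤ s → s ≤ ℓ → form a b c r s ≤ + 3 * c * (ℓ * ℓ)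
  form≤3cℓ² {ℓ} {r} {s} 0≤r r≤ℓ 0≤s s≤ℓ = ≤-by-gap
    (+-mono-≤ (+-mono-≤ (+-mono-≤ (+-mono-≤
      (0≤i*j (0≤i*j (0≤+ 2) 0≤c-a) (0≤i*i ℓ))
      (0≤i*j 0≤a (0≤i*j 0≤ℓ-r (+-mono-≤ 0≤ℓ 0≤r))))
      (0≤i*j 0≤a (+-mono-≤ (0≤i*j 0≤ℓ-r 0≤ℓ) (0≤i*j 0≤r 0≤ℓ-s))))
      (0≤i*j 0≤a-b (0≤i*j 0≤r 0≤s)))
      (0≤i*j 0≤c (0≤i*j 0≤ℓ-s (+-mono-≤ 0≤ℓ 0≤s))))
    (solve 6 (λ a b c l r s →
       Form a b c r s
         :+ (con (+ 2) :* (c :- a) :* (l :* l) :+ a :* ((l :- r) :* (l :+ r))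
             :+ a :* ((l :- r) :* l :+ r :* (l :- s)) :+ (a :- b) :* (r :* s) :+ c :* ((l :- s) :* (l :+ s)))
       := con (+ 3) :* c :* (l :* l)) refl a b c ℓ r s)
    where
    0≤ℓ : 0ℤ ≤ ℓ
    0≤ℓ = ≤-trans 0≤r r≤ℓ
    0≤ℓ-r : 0ℤ ≤ ℓ - r
    0≤ℓ-r = i≤j⇒0≤j-i r≤ℓ
    0≤ℓ-s : 0ℤ ≤ ℓ - s
    0≤ℓ-s = i≤j⇒0≤j-i s≤ℓ

  InRegion⇒form<36c : ∀ {ℓ r s u v} → 0ℤ ≤ r → r < ℓ → 0ℤ ≤ s → s < ℓ →
                      InRegion a b c ℓ r s (u , v) → form a b c u v < + 36 * c
  InRegion⇒form<36c {ℓ} {r} {s} {u} {v} 0≤r r<ℓ 0≤s s<ℓ inRegion =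
    *-cancelˡ-<-nonNeg (ℓ * ℓ) {{nonNegative (0≤i*i ℓ)}} (begin-strict
      ℓ * ℓ * form a b c u v       ≡⟨ form-scale a b c ℓ u v ⟨
      form a b c (ℓ * u) (ℓ * v)   <⟨ form<12form 2f[X-R]<f[X] ⟩
      + 12 * form a b c r s        ≤⟨ *-monoˡ-≤-nonNeg (+ 12) (form≤3cℓ² 0≤r (<⇒≤ r<ℓ) 0≤s (<⇒≤ s<ℓ)) ⟩
      + 12 * (+ 3 * c * (ℓ * ℓ))   ≡⟨ solve 2 (λ c l → con (+ 12) :* (con (+ 3) :* c :* (l :* l))
                                                       := l :* l :* (con (+ 36) :* c)) refl c ℓ ⟩
      ℓ * ℓ * (+ 36 * c)           ∎)
    where
    2f[X-R]<f[X] : + 2 * form a b c (ℓ * u - r) (ℓ * v - s) < form a b c (ℓ * u) (ℓ * v)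
    2f[X-R]<f[X] = subst (+ 2 * form a b c (ℓ * u - r) (ℓ * v - s) <_) (sym (form-scale a b c ℓ u v)) inRegion

  Bounded : ℤ × ℤ → Set
  Bounded (u , v) = a * (u * u) ≤ + 48 * c × ∣ v ∣ ℕ.≤ 6

  form<36c⇒Bounded : ∀ {u v} → form a b c u v < + 36 * c → Bounded (u , v)
  form<36c⇒Bounded {u} {v} f<36c = <⇒≤ au²<48c , ℕ.s≤s⁻¹ ∣v∣<7
    where
    4f<144c : + 4 * form a b c u v < + 144 * c
    4f<144c = subst (+ 4 * form a b c u v <_) (sym (*-assoc (+ 4) (+ 36) c)) (*-monoˡ-<-pos (+ 4) f<36c)

    au²<48c : a * (u * u) < + 48 * c
    au²<48c = *-cancelˡ-<-nonNeg (+ 3) (begin-strict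
      + 3 * (a * (u * u))    ≡⟨ *-assoc (+ 3) a (u * u) ⟨
      + 3 * a * (u * u)      ≤⟨ 3ax²≤4form u v ⟩
      + 4 * form a b c u v   <⟨ 4f<144c ⟩
      + 144 * c              ≡⟨ *-assoc (+ 3) (+ 48) c ⟩
      + 3 * (+ 48 * c)       ∎)

    v²<48 : v * v < + 48
    v²<48 = *-cancelˡ-<-nonNeg (+ 3 * c) {{nonNegative (0≤i*j (0≤+ 3) 0≤c)}} (begin-strict
      + 3 * c * (v * v)      ≤⟨ 3cy²≤4form u v ⟩
      + 4 * form a b c u v   <⟨ 4f<144c ⟩
      + 144 * c              ≡⟨ solve 1 (λ c → con (+ 144) :* c := con (+ 3) :* c :* con (+ 48)) refl c ⟩
      + 3 * c * + 48         ∎)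

    ∣v∣<7 : ∣ v ∣ ℕ.< 7
    ∣v∣<7 = m*m<n*n⇒m<n (ℕ.<-trans
      (drop‿+<+ (subst (_< + 48) (trans (i*i≡∣i∣*∣i∣ v) (sym (pos-* ∣ v ∣ ∣ v ∣))) v²<48))
      (ℕ.n<1+n 48))

  -- 65234 = 13² · 386
  box-bound : ∀ U → a * (U * U) ≤ + 48 * c →
              (1ℤ + + 2 * U) * + 13 * ((1ℤ + + 2 * U) * + 13) * a * a ≤ + 65234 * (a * c)
  box-bound U aU²≤48c = ≤-by-gap
    (0≤i*j (0≤+ 169) (+-mono-≤ (+-mono-≤
      (0≤i*j (0≤i*j (0≤+ 8) 0≤a) (i≤j⇒0≤j-i aU²≤48c))
      (0≤i*j (0≤i*i (+ 2 * U - 1ℤ)) (0≤i*i a)))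
      (0≤i*j (0≤i*j (0≤+ 2) 0≤a) 0≤c-a)))
    (solve 3 (λ a c U →
       (con (+ 1) :+ con (+ 2) :* U) :* con (+ 13) :* ((con (+ 1) :+ con (+ 2) :* U) :* con (+ 13)) :* a :* a
         :+ con (+ 169) :* (con (+ 8) :* a :* (con (+ 48) :* c :- a :* (U :* U))
                            :+ (con (+ 2) :* U :- con (+ 1)) :* (con (+ 2) :* U :- con (+ 1)) :* (a :* a)
                            :+ con (+ 2) :* a :* (c :- a))
       := con (+ 65234) :* (a :* c)) refl a c U)

  length²a²≤65234ac : ∀ {ps} → Unique ps → All Bounded ps →
                      + length ps * + length ps * a * a ≤ + 65234 * (a * c)
  length²a²≤65234ac {ps} unique bounded = begin
    + N * + N * a * a                       ≤⟨ *-monoʳ-≤-nonNeg a (*-monoʳ-≤-nonNeg a N²≤M²) ⟩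
    + M * + M * a * a                       ≡⟨ cong (λ m → m * m * a * a) +M≡ ⟩
    (1ℤ + + 2 * + U) * + 13 * ((1ℤ + + 2 * + U) * + 13) * a * a
                                            ≤⟨ box-bound (+ U) aU²≤48c ⟩
    + 65234 * (a * c)                       ∎
    where
    instance
      a-nonNeg : NonNegative a
      a-nonNeg = nonNegative 0≤a
    N : ℕ
    N = length ps
    u₀ : ℤ
    u₀ = proj₁ (argmax (∣_∣ ∘ proj₁) (0ℤ , 0ℤ) ps)
    U : ℕ
    U = ∣ u₀ ∣
    M : ℕ
    M = (1 ℕ.+ 2 ℕ.* U) ℕ.* 13
    N≤M : N ℕ.≤ M
    N≤M = length≤box unique (f[xs]≤f[argmax] (0ℤ , 0ℤ) ps) (All.map proj₂ bounded)
    N²≤M² : + N * + N ≤ + M * + M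
    N²≤M² = subst₂ _≤_ (pos-* N N) (pos-* M M) (+≤+ (ℕ.*-mono-≤ N≤M N≤M))
    +M≡ : + M ≡ (1ℤ + + 2 * + U) * + 13
    +M≡ = trans (pos-* (1 ℕ.+ 2 ℕ.* U) 13) (cong (_* + 13) (trans (pos-+ 1 (2 ℕ.* U)) (cong (λ k → 1ℤ + k) (pos-* 2 U))))
    Bounded[0,0] : Bounded (0ℤ , 0ℤ)
    Bounded[0,0] = subst (_≤ + 48 * c) (sym (*-zeroʳ a)) (0≤i*j (0≤+ 48) 0≤c) , ℕ.z≤n
    aU²≤48c : a * (+ U * + U) ≤ + 48 * c
    aU²≤48c = subst (λ t → a * t ≤ + 48 * c) (i*i≡∣i∣*∣i∣ u₀) (proj₁ (argmax-all (∣_∣ ∘ proj₁) Bounded[0,0] bounded))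

lemma2p2 : ∃ λ (C : ℕ) →
    ∀ (a b c : ℤ) → Reduced a b c →
    ∀ (ℓ r s : ℤ) → 1ℤ ≤ ℓ → 0ℤ ≤ r → r < ℓ → 0ℤ ≤ s → s < ℓ →
    ∀ (xs : List (ℤ × ℤ)) → Unique xs → All (InRegion a b c ℓ r s) xs →
    + (length xs) * + (length xs) * a * a ≤ + C * negDisc a b c
lemma2p2 = 65234 , λ where
  a b c (_ , (_ , 0<a) , ∣b∣≤a , a≤c , _) ℓ r s _ 0≤r r<ℓ 0≤s s<ℓ xs unique inRegion →
    let open ReducedForm {b = b} 0<a ∣b∣≤a a≤c in
    ≤-trans (length²a²≤65234ac unique (All.map (form<36c⇒Bounded ∘ InRegion⇒form<36c 0≤r r<ℓ 0≤s s<ℓ) inRegion))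
            (*-monoˡ-≤-nonNeg (+ 65234) a*c≤negDisc)
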